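{- For every positive integer $r$ and every type $\mathbf m=[m_2,m_3,\ldots]$, let $C^{(r)}_{\mathbf m}=[\mathbf t^{\mathbf m}]\,\mathbf S^r$. Then $$C^{(r)}_{\mathbf m}=\frac{r\,(r-1+2m_2+3m_3+\cdots)!}{(r+m_2+2m_3+\cdots)!\,m_2!\,m_3!\cdots}=\sum_{\substack{\sum_{\mathbf n\ge0}k_{\mathbf n}=r\\ \sum_{\mathbf n\ge0}k_{\mathbf n}\mathbf n=\mathbf m}}\binom{r}{\mathbf k}\prod_{\mathbf n\ge0}C_{\mathbf n}^{k_{\mathbf n}},$$ where the sum runs over families $\mathbf k=(k_{\mathbf n})_{\mathbf n}$ of natural numbers indexed by types, finitely many nonzero, satisfying the constraints, and $\binom{r}{\mathbf k}=r!/\prod_{\mathbf n}k_{\mathbf n}!$.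
   Context: A type is a vector $\mathbf m=[m_2,m_3,m_4,\ldots]$ of natural numbers (indices start at $2$) with finitely many nonzero entries. For variables $t_2,t_3,\ldots$, $\mathbf t^{\mathbf m}=t_2^{m_2}t_3^{m_3}\cdots$ and $[\mathbf t^{\mathbf m}]F$ is the coefficient of $\mathbf t^{\mathbf m}$ in a formal power series $F$. The hyper-Catalan number is $C_{\mathbf m}=\frac{(2m_2+3m_3+4m_4+\cdots)!}{(1+m_2+2m_3+3m_4+\cdots)!\,m_2!\,m_3!\cdots}$ (the number of subdivisions of a roofed polygon into $m_2$ triangles, $m_3$ quadrilaterals, etc.), and $\mathbf S=\sum_{\mathbf m}C_{\mathbf m}\mathbf t^{\mathbf m}$ is its generating series. -}

module Defs where

open import Data.Nat using (ℕ; zero; suc; _+_; _*_; _∸_; _^_; _!; _/_; NonZero)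
open import Data.Nat.Properties using (_!≢0; m*n≢0; _≟_)
open import Data.List using (List; []; _∷_; map; concatMap; upTo; zipWith; replicate; length)
open import Data.Nat.ListAction using (sum; product)
open import Data.List.Properties using (≡-dec)
open import Data.Bool using (Bool; true; false; if_then_else_)
open import Relation.Nullary.Decidable using (⌊_⌋)

-- A type m = [m₂, m₃, …] is represented by a finite list: entry i is m_{i+2}.
-- Lists differing only by trailing zeros represent the same type.
Type : Set
Type = List ℕ

wt : ℕ → Type → ℕ
wt k []       = 0
wt k (x ∷ xs) = k * x + wt (suc k) xs

factProd : List ℕ → ℕ
factProd xs = product (map _! xs)

factProd≢0 : ∀ xs → NonZero (factProd xs)
factProd≢0 []       = _
factProd≢0 (x ∷ xs) = m*n≢0 (x !) (factProd xs) {{x !≢0}} {{factProd≢0 xs}}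

divFact : ℕ → ℕ → List ℕ → ℕ
divFact a b xs = a / (b ! * factProd xs)
  where instance _ = m*n≢0 (b !) (factProd xs) {{b !≢0}} {{factProd≢0 xs}}

-- hyper-Catalan number  C_m = (2m₂+3m₃+…)! / ((1+m₂+2m₃+…)! m₂! m₃! …)
hyperCatalan : Type → ℕ
hyperCatalan m = divFact ((wt 2 m) !) (1 + wt 1 m) m

multinomial : ℕ → List ℕ → ℕ
multinomial r ks = divFact (r !) 0 ks

-- all types n ≤ m componentwise (as lists of the same length as m)
below : Type → List Type
below []       = [] ∷ []
below (x ∷ xs) = concatMap (λ a → map (a ∷_) (below xs)) (upTo (suc x))

-- formal power series in t₂, t₃, … with ℕ coefficients: coefficient function on types
Series : Set
Series = Type → ℕ

isZeroType : Type → Bool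
isZeroType []       = true
isZeroType (x ∷ xs) = if ⌊ x ≟ 0 ⌋ then isZeroType xs else false

one : Series
one m = if isZeroType m then 1 else 0

_⊛_ : Series → Series → Series
(F ⊛ G) m = sum (map (λ a → F a * G (zipWith _∸_ m a)) (below m))

_^ˢ_ : Series → ℕ → Series
F ^ˢ zero  = one
F ^ˢ suc r = F ⊛ (F ^ˢ r)

S : Series
S = hyperCatalan

comps : ℕ → ℕ → List (List ℕ)
comps zero    zero    = [] ∷ []
comps (suc r) zero    = []
comps r       (suc L) = concatMap (λ j → map (j ∷_) (comps (r ∸ j) L)) (upTo (suc r))

linComb : ℕ → List ℕ → List Type → Type
linComb len []       _        = replicate len 0
linComb len (_ ∷ _)  []       = replicate len 0
linComb len (k ∷ ks) (n ∷ ns) = zipWith _+_ (map (k *_) n) (linComb len ks ns)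

-- Σ over families k = (k_n)_n with Σ k_n = r and Σ k_n n = m of  (r choose k) ∏ C_n^{k_n}.
-- Only types n ≤ m can carry k_n > 0, so families are indexed by  below m .
multSum : ℕ → Type → ℕ
multSum r m = sum (map term (comps r (length ts)))
  where
  ts = below m
  term : List ℕ → ℕ
  term ks = if ⌊ ≡-dec _≟_ (linComb (length m) ks ts) m ⌋
            then multinomial r ks * product (zipWith (λ k n → hyperCatalan n ^ k) ks ts)
            else 0

-- Write E = wt 1 m = m₂ + 2m₃ + ⋯ and W = wt 2 m = 2m₂ + 3m₃ + ⋯.  The closed form is
-- proved by strong induction on W, simultaneously for all r.  For r = 1 it is the
-- definition of C_m, and with the closed form for lighter types it gives the functional
-- equation S = 1 + Σₖ tₖ Sᵏ coefficientwise, because Σₖ k mₖ = W.  Multiplying by Sʳ gives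
-- Sʳ⁺¹ = Sʳ + Σₖ tₖ Sʳ⁺ᵏ, and the closed form for r + 1 follows from the one for r since
-- r (r + 1 + E) + Σₖ (r + k) mₖ = (r + 1)(r + W).
--
-- The coefficient of Sʳ at m only involves the C_n with n ≤ m, so S may be replaced by the
-- polynomial Σ_{n ≤ m} C_n tⁿ.  Its r-th power is expanded by iterating the binomial theorem
-- of the standard library in the commutative semiring of series, which gives the sum over
-- the families k.

module Submission where

open import Defs
open import Algebra.Bundles using (CommutativeSemiring)
import Algebra.Construct.Pointwise as PointwiseAlgebra
open import Data.Bool using (true; false; if_then_else_)
open import Data.Fin using (toℕ)
open import Data.List using (List; []; _∷_; _++_; map; concatMap; upTo; applyUpTo; zipWith; replicate; length)
open import Data.List.Properties
  using (≡-dec; length-map; length-zipWith; length-replicate; map-cong; map-cong-local; map-++; map-∘)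
open import Data.List.Relation.Binary.Pointwise as Pointwise using (Pointwise; []; _∷_; Pointwise-length)
open import Data.List.Relation.Unary.All as All using (All; []; _∷_)
open import Data.List.Relation.Unary.All.Properties using (concat⁺; map⁺; applyUpTo⁺₁)
open import Data.Nat using (ℕ; zero; suc; _+_; _*_; _∸_; _^_; _!; _/_; _⊓_; _≤_; _<_; _≟_; s≤s; z≤n; s≤s⁻¹)
open import Data.Nat.Combinatorics using (_C_; nCk≡n!/k![n-k]!; k![n∸k]!∣n!)
open import Data.Nat.DivMod using (m*n/n≡m; m/n*n≡m)
open import Data.Nat.Induction using (<-wellFounded)
open import Data.Nat.ListAction using (sum; product)
open import Data.Nat.ListAction.Properties using (sum-++)
open import Data.Nat.Properties hiding (_≟_)
open import Algebra.Properties.CommutativeSemigroup *-commutativeSemigroup using (x∙yz≈y∙xz)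
open import Data.Nat.Tactic.RingSolver using (solve-∀)
open import Data.Product using (_×_; _,_)
open import Function using (_∘_)
import Induction.WellFounded as WellFounded
open import Relation.Binary.PropositionalEquality
import Relation.Binary.Construct.On as On
open import Relation.Nullary using (yes; no; contradiction)
open import Relation.Nullary.Decidable using (⌊_⌋)

-- Sums over initial segments of ℕ

∑< : ℕ → (ℕ → ℕ) → ℕ
∑< zero    f = 0
∑< (suc n) f = f 0 + ∑< n (f ∘ suc)

infix 5 ∑<
syntax ∑< n (λ a → e) = ∑[ a < n ] e

∑<-cong-< : ∀ n {f g : ℕ → ℕ} → (∀ a → a < n → f a ≡ g a) → ∑< n f ≡ ∑< n g
∑<-cong-< zero    eq = refl
∑<-cong-< (suc n) eq = cong₂ _+_ (eq 0 (s≤s z≤n)) (∑<-cong-< n (λ a a<n → eq (suc a) (s≤s a<n)))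

∑<-cong : ∀ n {f g : ℕ → ℕ} → f ≗ g → ∑< n f ≡ ∑< n g
∑<-cong n eq = ∑<-cong-< n (λ a _ → eq a)

∑<-zero : ∀ n {f : ℕ → ℕ} → (∀ a → f a ≡ 0) → ∑< n f ≡ 0
∑<-zero zero    eq = refl
∑<-zero (suc n) eq = cong₂ _+_ (eq 0) (∑<-zero n (eq ∘ suc))

+-interchange : ∀ a b c d → (a + b) + (c + d) ≡ (a + c) + (b + d)
+-interchange = solve-∀

∑<-+ : ∀ n (f g : ℕ → ℕ) → (∑[ a < n ] f a + g a) ≡ ∑< n f + ∑< n g
∑<-+ zero    f g = refl
∑<-+ (suc n) f g = begin
  f 0 + g 0 + (∑[ a < n ] f (suc a) + g (suc a)) ≡⟨ cong (f 0 + g 0 +_) (∑<-+ n (f ∘ suc) (g ∘ suc)) ⟩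
  f 0 + g 0 + (∑< n (f ∘ suc) + ∑< n (g ∘ suc)) ≡⟨ +-interchange (f 0) (g 0) _ _ ⟩
  ∑< (suc n) f + ∑< (suc n) g                   ∎
  where open ≡-Reasoning

∑<-*ˡ : ∀ n c (f : ℕ → ℕ) → (∑[ a < n ] c * f a) ≡ c * ∑< n f
∑<-*ˡ zero    c f = sym (*-zeroʳ c)
∑<-*ˡ (suc n) c f = trans (cong (c * f 0 +_) (∑<-*ˡ n c (f ∘ suc))) (sym (*-distribˡ-+ c (f 0) _))

∑<-*ʳ : ∀ n c (f : ℕ → ℕ) → (∑[ a < n ] f a * c) ≡ ∑< n f * c
∑<-*ʳ n c f = trans (∑<-cong n (λ a → *-comm (f a) c)) (trans (∑<-*ˡ n c f) (*-comm c _))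

∑<-last : ∀ n (f : ℕ → ℕ) → ∑< (suc n) f ≡ ∑< n f + f n
∑<-last zero    f = +-comm (f 0) 0
∑<-last (suc n) f = trans (cong (f 0 +_) (∑<-last n (f ∘ suc))) (sym (+-assoc (f 0) _ _))

∑<-reverse : ∀ x (f : ℕ → ℕ) → ∑< (suc x) f ≡ (∑[ a < suc x ] f (x ∸ a))
∑<-reverse zero    f = refl
∑<-reverse (suc x) f = begin
  ∑< (suc (suc x)) f                     ≡⟨ ∑<-last (suc x) f ⟩
  ∑< (suc x) f + f (suc x)               ≡⟨ cong (_+ f (suc x)) (∑<-reverse x f) ⟩
  (∑[ a < suc x ] f (x ∸ a)) + f (suc x) ≡⟨ +-comm _ (f (suc x)) ⟩
  (∑[ a < suc (suc x) ] f (suc x ∸ a))   ∎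
  where open ≡-Reasoning

-- Both sides sum g b c d over all b + c + d = x.
∑<-triangle : ∀ x (g : ℕ → ℕ → ℕ → ℕ) →
  (∑[ a < suc x ] ∑[ b < suc a ] g b (a ∸ b) (x ∸ a)) ≡ (∑[ b < suc x ] ∑[ c < suc (x ∸ b) ] g b c (x ∸ b ∸ c))
∑<-triangle zero    g = refl
∑<-triangle (suc x) g = begin
  g 0 0 (suc x) + 0 + (∑[ a < suc x ] g 0 (suc a) (x ∸ a) + (∑[ b < suc a ] g (suc b) (a ∸ b) (x ∸ a)))
    ≡⟨ cong (g 0 0 (suc x) + 0 +_) (∑<-+ (suc x) (λ a → g 0 (suc a) (x ∸ a)) (λ a → ∑[ b < suc a ] g (suc b) (a ∸ b) (x ∸ a))) ⟩
  g 0 0 (suc x) + 0 + (A + (∑[ a < suc x ] ∑[ b < suc a ] g (suc b) (a ∸ b) (x ∸ a)))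
    ≡⟨ cong (λ z → g 0 0 (suc x) + 0 + (A + z)) (∑<-triangle x (g ∘ suc)) ⟩
  g 0 0 (suc x) + 0 + (A + B)
    ≡⟨ reassoc (g 0 0 (suc x)) A B ⟩
  g 0 0 (suc x) + A + B ∎
  where
  open ≡-Reasoning
  A = ∑[ a < suc x ] g 0 (suc a) (x ∸ a)
  B = ∑[ b < suc x ] ∑[ c < suc (x ∸ b) ] g (suc b) c (x ∸ b ∸ c)
  reassoc : ∀ a b c → a + 0 + (b + c) ≡ a + b + c
  reassoc = solve-∀

private variable
  A B : Set

sum-map-zero : ∀ {f : A → ℕ} → (∀ x → f x ≡ 0) → ∀ xs → sum (map f xs) ≡ 0
sum-map-zero eq []       = refl
sum-map-zero eq (x ∷ xs) = cong₂ _+_ (eq x) (sum-map-zero eq xs)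

sum-map-+ : ∀ (f g : A → ℕ) xs → sum (map (λ x → f x + g x) xs) ≡ sum (map f xs) + sum (map g xs)
sum-map-+ f g []       = refl
sum-map-+ f g (x ∷ xs) = trans (cong (f x + g x +_) (sum-map-+ f g xs)) (+-interchange (f x) (g x) _ _)

sum-map-*ˡ : ∀ c (f : A → ℕ) xs → sum (map (λ x → c * f x) xs) ≡ c * sum (map f xs)
sum-map-*ˡ c f []       = sym (*-zeroʳ c)
sum-map-*ˡ c f (x ∷ xs) = trans (cong (c * f x +_) (sum-map-*ˡ c f xs)) (sym (*-distribˡ-+ c (f x) _))

sum-map-*ʳ : ∀ c (f : A → ℕ) xs → sum (map (λ x → f x * c) xs) ≡ sum (map f xs) * c
sum-map-*ʳ c f xs = begin
  sum (map (λ x → f x * c) xs) ≡⟨ cong sum (map-cong (λ x → *-comm (f x) c) xs) ⟩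
  sum (map (λ x → c * f x) xs) ≡⟨ sum-map-*ˡ c f xs ⟩
  c * sum (map f xs)           ≡⟨ *-comm c _ ⟩
  sum (map f xs) * c           ∎
  where open ≡-Reasoning

sum-map-∑< : ∀ n (g : A → ℕ → ℕ) xs → sum (map (λ x → ∑< n (g x)) xs) ≡ (∑[ j < n ] sum (map (λ x → g x j) xs))
sum-map-∑< n g []       = sym (∑<-zero n (λ _ → refl))
sum-map-∑< n g (x ∷ xs) = trans (cong (∑< n (g x) +_) (sum-map-∑< n g xs)) (sym (∑<-+ n (g x) _))

sum-map-swap : ∀ (g : A → B → ℕ) xs ys →
  sum (map (λ x → sum (map (g x) ys)) xs) ≡ sum (map (λ y → sum (map (λ x → g x y) xs)) ys)
sum-map-swap g []       ys = sym (sum-map-zero (λ _ → refl) ys)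
sum-map-swap g (x ∷ xs) ys = trans (cong (sum (map (g x) ys) +_) (sum-map-swap g xs ys))
                                   (sym (sum-map-+ (g x) (λ y → sum (map (λ x → g x y) xs)) ys))

sum-map-concatMap : ∀ (f : B → ℕ) (h : A → List B) xs →
  sum (map f (concatMap h xs)) ≡ sum (map (λ x → sum (map f (h x))) xs)
sum-map-concatMap f h []       = refl
sum-map-concatMap f h (x ∷ xs) = begin
  sum (map f (h x ++ concatMap h xs))              ≡⟨ cong sum (map-++ f (h x) (concatMap h xs)) ⟩
  sum (map f (h x) ++ map f (concatMap h xs))      ≡⟨ sum-++ (map f (h x)) _ ⟩
  sum (map f (h x)) + sum (map f (concatMap h xs)) ≡⟨ cong (sum (map f (h x)) +_) (sum-map-concatMap f h xs) ⟩
  sum (map f (h x)) + sum (map (λ x → sum (map f (h x))) xs) ∎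
  where open ≡-Reasoning

sum-map-upTo : ∀ n (f : ℕ → ℕ) → sum (map f (upTo n)) ≡ ∑< n f
sum-map-upTo n f = go n (λ a → a)
  where
  go : ∀ n (g : ℕ → ℕ) → sum (map f (applyUpTo g n)) ≡ ∑< n (f ∘ g)
  go zero    g = refl
  go (suc n) g = cong (f (g 0) +_) (go n (g ∘ suc))

sum-map-concatMap-∷ : ∀ x (l : ℕ → List (List ℕ)) (f : List ℕ → ℕ) →
  sum (map f (concatMap (λ j → map (j ∷_) (l j)) (upTo (suc x)))) ≡ (∑[ j < suc x ] sum (map (f ∘ (j ∷_)) (l j)))
sum-map-concatMap-∷ x l f = begin
  sum (map f (concatMap (λ j → map (j ∷_) (l j)) (upTo (suc x))))
    ≡⟨ sum-map-concatMap f (λ j → map (j ∷_) (l j)) (upTo (suc x)) ⟩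
  sum (map (λ j → sum (map f (map (j ∷_) (l j)))) (upTo (suc x)))
    ≡⟨ sum-map-upTo (suc x) _ ⟩
  (∑[ j < suc x ] sum (map f (map (j ∷_) (l j))))
    ≡⟨ ∑<-cong (suc x) (λ j → cong sum (sym (map-∘ {g = f} {f = j ∷_} (l j)))) ⟩
  (∑[ j < suc x ] sum (map (f ∘ (j ∷_)) (l j))) ∎
  where open ≡-Reasoning

-- Sums over the types below a type

infix 4 _≤ᵀ_
_≤ᵀ_ : Type → Type → Set
_≤ᵀ_ = Pointwise _≤_

infixl 6 _∸ᵀ_
_∸ᵀ_ : Type → Type → Type
_∸ᵀ_ = zipWith _∸_

∑≤ : Type → (Type → ℕ) → ℕ
∑≤ m f = sum (map f (below m))

infix 5 ∑≤
syntax ∑≤ m (λ b → e) = ∑[ b ≤ m ] e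

below-≤ᵀ : ∀ m → All (_≤ᵀ m) (below m)
below-≤ᵀ []       = [] ∷ []
below-≤ᵀ (x ∷ xs) = concat⁺ (map⁺ (applyUpTo⁺₁ (λ a → a) (suc x)
  (λ a<1+x → map⁺ (All.map (s≤s⁻¹ a<1+x ∷_) (below-≤ᵀ xs)))))

∑≤-cong : ∀ m {f g : Type → ℕ} → (∀ b → b ≤ᵀ m → f b ≡ g b) → ∑≤ m f ≡ ∑≤ m g
∑≤-cong m eq = cong sum (map-cong-local (All.map (eq _) (below-≤ᵀ m)))

∑≤-∷ : ∀ x xs (f : Type → ℕ) → ∑≤ (x ∷ xs) f ≡ (∑[ a < suc x ] ∑[ v ≤ xs ] f (a ∷ v))
∑≤-∷ x xs f = sum-map-concatMap-∷ x (λ _ → below xs) f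

∑≤-reverse : ∀ m (f : Type → ℕ) → ∑≤ m f ≡ (∑[ b ≤ m ] f (m ∸ᵀ b))
∑≤-reverse []       f = refl
∑≤-reverse (x ∷ xs) f = begin
  ∑≤ (x ∷ xs) f                                   ≡⟨ ∑≤-∷ x xs f ⟩
  (∑[ a < suc x ] ∑[ v ≤ xs ] f (a ∷ v))           ≡⟨ ∑<-cong (suc x) (λ a → ∑≤-reverse xs (λ v → f (a ∷ v))) ⟩
  (∑[ a < suc x ] ∑[ v ≤ xs ] f (a ∷ xs ∸ᵀ v))     ≡⟨ ∑<-reverse x (λ a → ∑[ v ≤ xs ] f (a ∷ xs ∸ᵀ v)) ⟩
  (∑[ a < suc x ] ∑[ v ≤ xs ] f (x ∸ a ∷ xs ∸ᵀ v)) ≡⟨ ∑≤-∷ x xs (λ b → f ((x ∷ xs) ∸ᵀ b)) ⟨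
  (∑[ b ≤ x ∷ xs ] f ((x ∷ xs) ∸ᵀ b))              ∎
  where open ≡-Reasoning

∑≤-triangle : ∀ m (ψ : Type → Type → Type → ℕ) →
  (∑[ a ≤ m ] ∑[ b ≤ a ] ψ b (a ∸ᵀ b) (m ∸ᵀ a)) ≡ (∑[ b ≤ m ] ∑[ c ≤ m ∸ᵀ b ] ψ b c (m ∸ᵀ b ∸ᵀ c))
∑≤-triangle []       ψ = refl
∑≤-triangle (x ∷ xs) ψ = begin
  (∑[ a ≤ x ∷ xs ] ∑[ b ≤ a ] ψ b (a ∸ᵀ b) ((x ∷ xs) ∸ᵀ a))
    ≡⟨ ∑≤-∷ x xs (λ a → ∑[ b ≤ a ] ψ b (a ∸ᵀ b) ((x ∷ xs) ∸ᵀ a)) ⟩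
  (∑[ a₀ < suc x ] ∑[ a ≤ xs ] ∑[ b ≤ a₀ ∷ a ] ψ b ((a₀ ∷ a) ∸ᵀ b) (x ∸ a₀ ∷ xs ∸ᵀ a))
    ≡⟨ ∑<-cong (suc x) (λ a₀ → ∑≤-cong xs (λ a _ → ∑≤-∷ a₀ a (λ b → ψ b ((a₀ ∷ a) ∸ᵀ b) (x ∸ a₀ ∷ xs ∸ᵀ a)))) ⟩
  (∑[ a₀ < suc x ] ∑[ a ≤ xs ] ∑[ b₀ < suc a₀ ] ∑[ b ≤ a ] Ψ b₀ (a₀ ∸ b₀) (x ∸ a₀) b (a ∸ᵀ b) (xs ∸ᵀ a))
    ≡⟨ ∑<-cong (suc x) (λ a₀ →
         sum-map-∑< (suc a₀) (λ a b₀ → ∑[ b ≤ a ] Ψ b₀ (a₀ ∸ b₀) (x ∸ a₀) b (a ∸ᵀ b) (xs ∸ᵀ a)) (below xs)) ⟩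
  (∑[ a₀ < suc x ] ∑[ b₀ < suc a₀ ] ∑[ a ≤ xs ] ∑[ b ≤ a ] Ψ b₀ (a₀ ∸ b₀) (x ∸ a₀) b (a ∸ᵀ b) (xs ∸ᵀ a))
    ≡⟨ ∑<-cong (suc x) (λ a₀ → ∑<-cong (suc a₀) (λ b₀ → ∑≤-triangle xs (Ψ b₀ (a₀ ∸ b₀) (x ∸ a₀)))) ⟩
  (∑[ a₀ < suc x ] ∑[ b₀ < suc a₀ ] g b₀ (a₀ ∸ b₀) (x ∸ a₀))
    ≡⟨ ∑<-triangle x g ⟩
  (∑[ b₀ < suc x ] ∑[ c₀ < suc (x ∸ b₀) ] g b₀ c₀ (x ∸ b₀ ∸ c₀))
    ≡⟨ ∑<-cong (suc x) (λ b₀ →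
         sum-map-∑< (suc (x ∸ b₀)) (λ b c₀ → ∑[ c ≤ xs ∸ᵀ b ] Ψ b₀ c₀ (x ∸ b₀ ∸ c₀) b c (xs ∸ᵀ b ∸ᵀ c)) (below xs)) ⟨
  (∑[ b₀ < suc x ] ∑[ b ≤ xs ] ∑[ c₀ < suc (x ∸ b₀) ] ∑[ c ≤ xs ∸ᵀ b ] Ψ b₀ c₀ (x ∸ b₀ ∸ c₀) b c (xs ∸ᵀ b ∸ᵀ c))
    ≡⟨ ∑<-cong (suc x) (λ b₀ → ∑≤-cong xs (λ b _ →
         ∑≤-∷ (x ∸ b₀) (xs ∸ᵀ b) (λ c → ψ (b₀ ∷ b) c ((x ∷ xs) ∸ᵀ (b₀ ∷ b) ∸ᵀ c)))) ⟨
  (∑[ b₀ < suc x ] ∑[ b ≤ xs ] ∑[ c ≤ x ∸ b₀ ∷ xs ∸ᵀ b ] ψ (b₀ ∷ b) c ((x ∷ xs) ∸ᵀ (b₀ ∷ b) ∸ᵀ c))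
    ≡⟨ ∑≤-∷ x xs (λ b → ∑[ c ≤ (x ∷ xs) ∸ᵀ b ] ψ b c ((x ∷ xs) ∸ᵀ b ∸ᵀ c)) ⟨
  (∑[ b ≤ x ∷ xs ] ∑[ c ≤ (x ∷ xs) ∸ᵀ b ] ψ b c ((x ∷ xs) ∸ᵀ b ∸ᵀ c)) ∎
  where
  open ≡-Reasoning
  Ψ : ℕ → ℕ → ℕ → Type → Type → Type → ℕ
  Ψ b₀ c₀ d₀ b c d = ψ (b₀ ∷ b) (c₀ ∷ c) (d₀ ∷ d)
  g : ℕ → ℕ → ℕ → ℕ
  g b₀ c₀ d₀ = ∑[ b ≤ xs ] ∑[ c ≤ xs ∸ᵀ b ] Ψ b₀ c₀ d₀ b c (xs ∸ᵀ b ∸ᵀ c)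

∸ᵀ-≤ᵀ : ∀ {b m} → b ≤ᵀ m → m ∸ᵀ b ≤ᵀ m
∸ᵀ-≤ᵀ []                       = []
∸ᵀ-≤ᵀ {a ∷ _} {x ∷ _} (_ ∷ b≤m) = m∸n≤m x a ∷ ∸ᵀ-≤ᵀ b≤m

∸ᵀ-involutive : ∀ {b m} → b ≤ᵀ m → m ∸ᵀ (m ∸ᵀ b) ≡ b
∸ᵀ-involutive []              = refl
∸ᵀ-involutive (a≤x ∷ b≤m) = cong₂ _∷_ (m∸[m∸n]≡n a≤x) (∸ᵀ-involutive b≤m)

-- The commutative semiring of series

0ˢ : Series
0ˢ _ = 0

infixl 6 _+ˢ_
_+ˢ_ : Series → Series → Series
(F +ˢ G) m = F m + G m

⊛-∷ : ∀ (F G : Series) x xs → (F ⊛ G) (x ∷ xs) ≡ (∑[ a < suc x ] ((λ v → F (a ∷ v)) ⊛ (λ v → G (x ∸ a ∷ v))) xs)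
⊛-∷ F G x xs = ∑≤-∷ x xs (λ b → F b * G ((x ∷ xs) ∸ᵀ b))

⊛-cong-≤ᵀ : ∀ {F F′ G G′ : Series} m → (∀ b → b ≤ᵀ m → F b ≡ F′ b) → (∀ c → c ≤ᵀ m → G c ≡ G′ c) →
  (F ⊛ G) m ≡ (F′ ⊛ G′) m
⊛-cong-≤ᵀ m eqF eqG = ∑≤-cong m (λ b b≤m → cong₂ _*_ (eqF b b≤m) (eqG (m ∸ᵀ b) (∸ᵀ-≤ᵀ b≤m)))

⊛-cong : ∀ {F F′ G G′ : Series} → F ≗ F′ → G ≗ G′ → F ⊛ G ≗ F′ ⊛ G′
⊛-cong eqF eqG m = ⊛-cong-≤ᵀ m (λ b _ → eqF b) (λ c _ → eqG c)

⊛-identityˡ : ∀ G → one ⊛ G ≗ G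
⊛-identityˡ G []       = trans (+-identityʳ _) (+-identityʳ _)
⊛-identityˡ G (x ∷ xs) = begin
  (one ⊛ G) (x ∷ xs)
    ≡⟨ ⊛-∷ one G x xs ⟩
  (one ⊛ (λ v → G (x ∷ v))) xs + (∑[ a < x ] ∑[ v ≤ xs ] one (suc a ∷ v) * G (x ∸ suc a ∷ xs ∸ᵀ v))
    ≡⟨ cong₂ _+_ (⊛-identityˡ (λ v → G (x ∷ v)) xs) (∑<-zero x (λ a → sum-map-zero (λ _ → refl) (below xs))) ⟩
  G (x ∷ xs) + 0
    ≡⟨ +-identityʳ _ ⟩
  G (x ∷ xs) ∎
  where open ≡-Reasoning

⊛-zeroˡ : ∀ G → 0ˢ ⊛ G ≗ 0ˢ
⊛-zeroˡ G m = sum-map-zero (λ _ → refl) (below m)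

⊛-assoc : ∀ F G H → (F ⊛ G) ⊛ H ≗ F ⊛ (G ⊛ H)
⊛-assoc F G H m = begin
  (∑[ a ≤ m ] (∑[ b ≤ a ] F b * G (a ∸ᵀ b)) * H (m ∸ᵀ a))
    ≡⟨ ∑≤-cong m (λ a _ → sum-map-*ʳ (H (m ∸ᵀ a)) (λ b → F b * G (a ∸ᵀ b)) (below a)) ⟨
  (∑[ a ≤ m ] ∑[ b ≤ a ] F b * G (a ∸ᵀ b) * H (m ∸ᵀ a))
    ≡⟨ ∑≤-triangle m (λ b c d → F b * G c * H d) ⟩
  (∑[ b ≤ m ] ∑[ c ≤ m ∸ᵀ b ] F b * G c * H (m ∸ᵀ b ∸ᵀ c))
    ≡⟨ ∑≤-cong m (λ b _ → trans (∑≤-cong (m ∸ᵀ b) (λ c _ → *-assoc (F b) (G c) _))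
                                (sum-map-*ˡ (F b) (λ c → G c * H (m ∸ᵀ b ∸ᵀ c)) (below (m ∸ᵀ b)))) ⟩
  (∑[ b ≤ m ] F b * (∑[ c ≤ m ∸ᵀ b ] G c * H (m ∸ᵀ b ∸ᵀ c))) ∎
  where open ≡-Reasoning

⊛-comm : ∀ F G → F ⊛ G ≗ G ⊛ F
⊛-comm F G m = begin
  (∑[ b ≤ m ] F b * G (m ∸ᵀ b))              ≡⟨ ∑≤-reverse m (λ b → F b * G (m ∸ᵀ b)) ⟩
  (∑[ b ≤ m ] F (m ∸ᵀ b) * G (m ∸ᵀ (m ∸ᵀ b))) ≡⟨ ∑≤-cong m (λ b b≤m → cong (λ c → F (m ∸ᵀ b) * G c) (∸ᵀ-involutive b≤m)) ⟩
  (∑[ b ≤ m ] F (m ∸ᵀ b) * G b)              ≡⟨ ∑≤-cong m (λ b _ → *-comm (F (m ∸ᵀ b)) (G b)) ⟩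
  (∑[ b ≤ m ] G b * F (m ∸ᵀ b))              ∎
  where open ≡-Reasoning

⊛-distribʳ-+ : ∀ H F G → (F +ˢ G) ⊛ H ≗ (F ⊛ H) +ˢ (G ⊛ H)
⊛-distribʳ-+ H F G m = trans (∑≤-cong m (λ b _ → *-distribʳ-+ (H (m ∸ᵀ b)) (F b) (G b)))
                             (sum-map-+ (λ b → F b * H (m ∸ᵀ b)) (λ b → G b * H (m ∸ᵀ b)) (below m))

⊛-*ˡ : ∀ c F G → (λ b → c * F b) ⊛ G ≗ (λ m → c * (F ⊛ G) m)
⊛-*ˡ c F G m = trans (∑≤-cong m (λ b _ → *-assoc c (F b) (G (m ∸ᵀ b))))
                     (sum-map-*ˡ c (λ b → F b * G (m ∸ᵀ b)) (below m))

⊛-*ʳ : ∀ c F G → F ⊛ (λ b → c * G b) ≗ (λ m → c * (F ⊛ G) m)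
⊛-*ʳ c F G m = trans (∑≤-cong m (λ b _ → x∙yz≈y∙xz (F b) c (G (m ∸ᵀ b))))
                     (sum-map-*ˡ c (λ b → F b * G (m ∸ᵀ b)) (below m))

series-commutativeSemiring : CommutativeSemiring _ _
series-commutativeSemiring = record
  { Carrier = Series
  ; _≈_     = _≗_
  ; _+_     = _+ˢ_
  ; _*_     = _⊛_
  ; 0#      = 0ˢ
  ; 1#      = one
  ; isCommutativeSemiring = record
    { isSemiring = record
      { isSemiringWithoutAnnihilatingZero = record
        { +-isCommutativeMonoid = PointwiseAlgebra.isCommutativeMonoid Type +-0-isCommutativeMonoid
        ; *-cong     = ⊛-cong
        ; *-assoc    = ⊛-assoc
        ; *-identity = ⊛-identityˡ , (λ G m → trans (⊛-comm G one m) (⊛-identityˡ G m))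
        ; distrib    = (λ H F G m → trans (⊛-comm H (F +ˢ G) m)
                                   (trans (⊛-distribʳ-+ H F G m) (cong₂ _+_ (⊛-comm F H m) (⊛-comm G H m))))
                     , ⊛-distribʳ-+
        }
      ; zero = ⊛-zeroˡ , (λ F m → trans (⊛-comm F 0ˢ m) (⊛-zeroˡ F m))
      }
    ; *-comm = ⊛-comm
    }
  }

^ˢ-+ : ∀ F k j → F ^ˢ (k + j) ≗ (F ^ˢ k) ⊛ (F ^ˢ j)
^ˢ-+ F zero    j m = sym (⊛-identityˡ (F ^ˢ j) m)
^ˢ-+ F (suc k) j m = trans (⊛-cong {F} (λ _ → refl) (^ˢ-+ F k j) m) (sym (⊛-assoc F (F ^ˢ k) (F ^ˢ j) m))

^ˢ-cong-≤ᵀ : ∀ {F G : Series} m → (∀ b → b ≤ᵀ m → F b ≡ G b) → ∀ r → (F ^ˢ r) m ≡ (G ^ˢ r) m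
^ˢ-cong-≤ᵀ m eq zero    = refl
^ˢ-cong-≤ᵀ m eq (suc r) = ⊛-cong-≤ᵀ m eq (λ c c≤m → ^ˢ-cong-≤ᵀ c (λ b b≤c → eq b (≤ᵀ-trans b≤c c≤m)) r)
  where ≤ᵀ-trans = Pointwise.transitive ≤-trans

open import Algebra.Definitions.RawSemiring (CommutativeSemiring.rawSemiring series-commutativeSemiring)
  using () renaming (_×_ to _×ˢ_; _^_ to _^ᴿ_; sum to ∑ˢ)
open import Algebra.Properties.CommutativeSemiring.Binomial series-commutativeSemiring
  using (binomialExpansion) renaming (theorem to binomialTheorem)

^ˢ≗^ᴿ : ∀ F n → F ^ˢ n ≗ F ^ᴿ n
^ˢ≗^ᴿ F zero    _ = refl
^ˢ≗^ᴿ F (suc n)   = ⊛-cong {F} (λ _ → refl) (^ˢ≗^ᴿ F n)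

×ˢ-coefficient : ∀ n F m → (n ×ˢ F) m ≡ n * F m
×ˢ-coefficient zero    F m = refl
×ˢ-coefficient (suc n) F m = cong (F m +_) (×ˢ-coefficient n F m)

∑ˢ-coefficient : ∀ n (T : ℕ → Series) m → ∑ˢ {n} (T ∘ toℕ) m ≡ (∑[ j < n ] T j m)
∑ˢ-coefficient zero    T m = refl
∑ˢ-coefficient (suc n) T m = cong (T 0 m +_) (∑ˢ-coefficient n (T ∘ suc) m)

⊛-binomial : ∀ F G n m → ((F +ˢ G) ^ˢ n) m ≡ (∑[ j < suc n ] (n C j) * ((F ^ˢ j) ⊛ (G ^ˢ (n ∸ j))) m)
⊛-binomial F G n m = begin
  ((F +ˢ G) ^ˢ n) m
    ≡⟨ ^ˢ≗^ᴿ (F +ˢ G) n m ⟩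
  ((F +ˢ G) ^ᴿ n) m
    ≡⟨ binomialTheorem n F G m ⟩
  binomialExpansion F G n m
    ≡⟨ ∑ˢ-coefficient (suc n) (λ j → (n C j) ×ˢ ((F ^ᴿ j) ⊛ (G ^ᴿ (n ∸ j)))) m ⟩
  (∑[ j < suc n ] ((n C j) ×ˢ ((F ^ᴿ j) ⊛ (G ^ᴿ (n ∸ j)))) m)
    ≡⟨ ∑<-cong (suc n) (λ j → trans (×ˢ-coefficient (n C j) ((F ^ᴿ j) ⊛ (G ^ᴿ (n ∸ j))) m)
                                     (cong ((n C j) *_) (sym (⊛-cong (^ˢ≗^ᴿ F j) (^ˢ≗^ᴿ G (n ∸ j)) m)))) ⟩
  (∑[ j < suc n ] (n C j) * ((F ^ˢ j) ⊛ (G ^ˢ (n ∸ j))) m) ∎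
  where open ≡-Reasoning

δ : ℕ → ℕ → ℕ
δ p q = if ⌊ p ≟ q ⌋ then 1 else 0

-- Types differing by trailing zeros are distinct, so monomial t behaves as the monomial with
-- exponent vector t only on types of the same length as t.
monomial : Type → Series
monomial t b = if ⌊ ≡-dec _≟_ t b ⌋ then 1 else 0

δ-≡ : ∀ p q → p ≡ q → δ p q ≡ 1
δ-≡ p q p≡q with p ≟ q
... | yes _   = refl
... | no  p≢q = contradiction p≡q p≢q

δ-≢ : ∀ p q → p ≢ q → δ p q ≡ 0
δ-≢ p q p≢q with p ≟ q
... | yes p≡q = contradiction p≡q p≢q
... | no  _   = refl

δ-resp-⇔ : ∀ {p q p′ q′} → (p ≡ q → p′ ≡ q′) → (p′ ≡ q′ → p ≡ q) → δ p q ≡ δ p′ q′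
δ-resp-⇔ {p} {q} {p′} {q′} to from with p ≟ q
... | yes p≡q = sym (δ-≡ p′ q′ (to p≡q))
... | no  p≢q = sym (δ-≢ p′ q′ (p≢q ∘ from))

δ-sym : ∀ p q → δ p q ≡ δ q p
δ-sym p q = δ-resp-⇔ sym sym

δ-suc : ∀ p q → δ (suc p) (suc q) ≡ δ p q
δ-suc p q = δ-resp-⇔ suc-injective (cong suc)

monomial-∷ : ∀ a t y b → monomial (a ∷ t) (y ∷ b) ≡ δ a y * monomial t b
monomial-∷ a t y b with a ≟ y | ≡-dec _≟_ t b
... | yes _ | yes _ = refl
... | yes _ | no  _ = refl
... | no  _ | yes _ = refl
... | no  _ | no  _ = refl

∑<-δ : ∀ n y (h : ℕ → ℕ) → y < n → (∑[ a < n ] δ y a * h a) ≡ h y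
∑<-δ (suc n) zero    h _         = trans (cong₂ _+_ (+-identityʳ (h 0)) (∑<-zero n (λ _ → refl))) (+-identityʳ (h 0))
∑<-δ (suc n) (suc y) h (s≤s y<n) = trans (∑<-cong n (λ a → cong (_* h (suc a)) (δ-suc y a))) (∑<-δ n y (h ∘ suc) y<n)

∑<-δ-out : ∀ n y (h : ℕ → ℕ) → n ≤ y → (∑[ a < n ] δ y a * h a) ≡ 0
∑<-δ-out zero    y       h _         = refl
∑<-δ-out (suc n) (suc y) h (s≤s n≤y) = trans (∑<-cong n (λ a → cong (_* h (suc a)) (δ-suc y a))) (∑<-δ-out n y (h ∘ suc) n≤y)

δ-convolution : ∀ x s v → (∑[ a < suc x ] δ s a * δ v (x ∸ a)) ≡ δ (s + v) x
δ-convolution x s v with s ≤? x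
... | no  s≰x = begin
  (∑[ a < suc x ] δ s a * δ v (x ∸ a)) ≡⟨ ∑<-δ-out (suc x) s (λ a → δ v (x ∸ a)) x<s ⟩
  0                                    ≡⟨ δ-≢ (s + v) x (λ s+v≡x → <⇒≱ x<s (subst (s ≤_) s+v≡x (m≤m+n s v))) ⟨
  δ (s + v) x                          ∎
  where
  open ≡-Reasoning
  x<s = ≰⇒> s≰x
... | yes s≤x = begin
  (∑[ a < suc x ] δ s a * δ v (x ∸ a)) ≡⟨ ∑<-δ (suc x) s (λ a → δ v (x ∸ a)) (s≤s s≤x) ⟩
  δ v (x ∸ s)                          ≡⟨ δ-resp-⇔ (λ v≡x∸s → trans (cong (s +_) v≡x∸s) (m+[n∸m]≡n s≤x))
                                                  (λ s+v≡x → trans (sym (m+n∸m≡n s v)) (cong (_∸ s) s+v≡x)) ⟩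
  δ (s + v) x                          ∎
  where open ≡-Reasoning

monomial-⊛ : ∀ m s v → length s ≡ length m → length v ≡ length m →
  (monomial s ⊛ monomial v) m ≡ monomial (zipWith _+_ s v) m
monomial-⊛ []       []       []       _   _   = refl
monomial-⊛ (x ∷ xs) (s₀ ∷ s) (v₀ ∷ v) |s| |v| = begin
  (monomial (s₀ ∷ s) ⊛ monomial (v₀ ∷ v)) (x ∷ xs)
    ≡⟨ ⊛-∷ (monomial (s₀ ∷ s)) (monomial (v₀ ∷ v)) x xs ⟩
  (∑[ a < suc x ] ((λ b → monomial (s₀ ∷ s) (a ∷ b)) ⊛ (λ b → monomial (v₀ ∷ v) (x ∸ a ∷ b))) xs)
    ≡⟨ ∑<-cong (suc x) (λ a → ⊛-cong (monomial-∷ s₀ s a) (monomial-∷ v₀ v (x ∸ a)) xs) ⟩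
  (∑[ a < suc x ] ((λ b → δ s₀ a * monomial s b) ⊛ (λ b → δ v₀ (x ∸ a) * monomial v b)) xs)
    ≡⟨ ∑<-cong (suc x) (λ a → trans (⊛-*ˡ (δ s₀ a) (monomial s) (λ b → δ v₀ (x ∸ a) * monomial v b) xs)
                              (trans (cong (δ s₀ a *_) (⊛-*ʳ (δ v₀ (x ∸ a)) (monomial s) (monomial v) xs))
                                     (sym (*-assoc (δ s₀ a) (δ v₀ (x ∸ a)) ((monomial s ⊛ monomial v) xs))))) ⟩
  (∑[ a < suc x ] δ s₀ a * δ v₀ (x ∸ a) * (monomial s ⊛ monomial v) xs)
    ≡⟨ ∑<-*ʳ (suc x) _ (λ a → δ s₀ a * δ v₀ (x ∸ a)) ⟩
  (∑[ a < suc x ] δ s₀ a * δ v₀ (x ∸ a)) * (monomial s ⊛ monomial v) xs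
    ≡⟨ cong₂ _*_ (δ-convolution x s₀ v₀) (monomial-⊛ xs s v (suc-injective |s|) (suc-injective |v|)) ⟩
  δ (s₀ + v₀) x * monomial (zipWith _+_ s v) xs
    ≡⟨ monomial-∷ (s₀ + v₀) (zipWith _+_ s v) x xs ⟨
  monomial (zipWith _+_ (s₀ ∷ s) (v₀ ∷ v)) (x ∷ xs) ∎
  where open ≡-Reasoning

one≗monomial-0 : ∀ m → one m ≡ monomial (replicate (length m) 0) m
one≗monomial-0 []           = refl
one≗monomial-0 (zero  ∷ xs) = trans (one≗monomial-0 xs) (sym (trans (monomial-∷ 0 (replicate (length xs) 0) 0 xs) (+-identityʳ _)))
one≗monomial-0 (suc x ∷ xs) = sym (monomial-∷ 0 (replicate (length xs) 0) (suc x) xs)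

∑≤-monomial : ∀ m b → b ≤ᵀ m → (g : Series) → (∑[ t ≤ m ] monomial t b * g t) ≡ g b
∑≤-monomial []       []      []          g = trans (+-identityʳ _) (+-identityʳ (g []))
∑≤-monomial (x ∷ xs) (y ∷ b) (y≤x ∷ b≤m) g = begin
  (∑[ t ≤ x ∷ xs ] monomial t (y ∷ b) * g t)
    ≡⟨ ∑≤-∷ x xs (λ t → monomial t (y ∷ b) * g t) ⟩
  (∑[ a < suc x ] ∑[ t ≤ xs ] monomial (a ∷ t) (y ∷ b) * g (a ∷ t))
    ≡⟨ ∑<-cong (suc x) (λ a → ∑≤-cong xs (λ t _ → cong (_* g (a ∷ t)) (monomial-∷ a t y b))) ⟩
  (∑[ a < suc x ] ∑[ t ≤ xs ] δ a y * monomial t b * g (a ∷ t))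
    ≡⟨ ∑<-cong (suc x) (λ a → trans (∑≤-cong xs (λ t _ → *-assoc (δ a y) (monomial t b) (g (a ∷ t))))
                                     (sum-map-*ˡ (δ a y) (λ t → monomial t b * g (a ∷ t)) (below xs))) ⟩
  (∑[ a < suc x ] δ a y * (∑[ t ≤ xs ] monomial t b * g (a ∷ t)))
    ≡⟨ ∑<-cong (suc x) (λ a → cong (_* (∑[ t ≤ xs ] monomial t b * g (a ∷ t))) (δ-sym a y)) ⟩
  (∑[ a < suc x ] δ y a * (∑[ t ≤ xs ] monomial t b * g (a ∷ t)))
    ≡⟨ ∑<-δ (suc x) y (λ a → ∑[ t ≤ xs ] monomial t b * g (a ∷ t)) (s≤s y≤x) ⟩
  (∑[ t ≤ xs ] monomial t b * g (y ∷ t))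
    ≡⟨ ∑≤-monomial xs b b≤m (λ t → g (y ∷ t)) ⟩
  g (y ∷ b) ∎
  where open ≡-Reasoning

map-0* : ∀ t → map (0 *_) t ≡ replicate (length t) 0
map-0* []      = refl
map-0* (x ∷ t) = cong (0 ∷_) (map-0* t)

zipWith-+-map-* : ∀ j t → zipWith _+_ t (map (j *_) t) ≡ map (suc j *_) t
zipWith-+-map-* j []      = refl
zipWith-+-map-* j (x ∷ t) = cong (x + j * x ∷_) (zipWith-+-map-* j t)

monomial-^ˢ : ∀ c t j b → length b ≡ length t → ((λ u → monomial t u * c) ^ˢ j) b ≡ c ^ j * monomial (map (j *_) t) b
monomial-^ˢ c t zero    b |b| = begin
  one b                                ≡⟨ one≗monomial-0 b ⟩
  monomial (replicate (length b) 0) b  ≡⟨ cong (λ t′ → monomial t′ b) (trans (cong (λ l → replicate l 0) |b|) (sym (map-0* t))) ⟩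
  monomial (map (0 *_) t) b            ≡⟨ +-identityʳ _ ⟨
  1 * monomial (map (0 *_) t) b        ∎
  where open ≡-Reasoning
monomial-^ˢ c t (suc j) b |b| = begin
  ((λ u → monomial t u * c) ⊛ ((λ u → monomial t u * c) ^ˢ j)) b
    ≡⟨ ⊛-cong-≤ᵀ b (λ u _ → *-comm (monomial t u) c) (λ u u≤b → monomial-^ˢ c t j u (trans (Pointwise-length u≤b) |b|)) ⟩
  ((λ u → c * monomial t u) ⊛ (λ u → c ^ j * monomial jt u)) b
    ≡⟨ ⊛-*ˡ c (monomial t) (λ u → c ^ j * monomial jt u) b ⟩
  c * ((monomial t ⊛ (λ u → c ^ j * monomial jt u)) b)
    ≡⟨ cong (c *_) (⊛-*ʳ (c ^ j) (monomial t) (monomial jt) b) ⟩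
  c * (c ^ j * (monomial t ⊛ monomial jt) b)
    ≡⟨ *-assoc c (c ^ j) _ ⟨
  c ^ suc j * (monomial t ⊛ monomial jt) b
    ≡⟨ cong (c ^ suc j *_) (monomial-⊛ b t jt (sym |b|) (trans (length-map (j *_) t) (sym |b|))) ⟩
  c ^ suc j * monomial (zipWith _+_ t jt) b
    ≡⟨ cong (λ t′ → c ^ suc j * monomial t′ b) (zipWith-+-map-* j t) ⟩
  c ^ suc j * monomial (map (suc j *_) t) b ∎
  where
  open ≡-Reasoning
  jt = map (j *_) t

⊛-binomial-monomial : ∀ c t B r m → length m ≡ length t →
  (((λ u → monomial t u * c) +ˢ B) ^ˢ r) m ≡ (∑[ j < suc r ] (r C j) * c ^ j * (monomial (map (j *_) t) ⊛ (B ^ˢ (r ∸ j))) m)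
⊛-binomial-monomial c t B r m |m| = trans (⊛-binomial (λ u → monomial t u * c) B r m) (∑<-cong (suc r) term)
  where
  term : ∀ j → (r C j) * (((λ u → monomial t u * c) ^ˢ j) ⊛ (B ^ˢ (r ∸ j))) m
             ≡ (r C j) * c ^ j * (monomial (map (j *_) t) ⊛ (B ^ˢ (r ∸ j))) m
  term j = begin
    (r C j) * (((λ u → monomial t u * c) ^ˢ j) ⊛ (B ^ˢ (r ∸ j))) m
      ≡⟨ cong ((r C j) *_) (⊛-cong-≤ᵀ {G = B ^ˢ (r ∸ j)} m (λ u u≤m → monomial-^ˢ c t j u (trans (Pointwise-length u≤m) |m|)) (λ _ _ → refl)) ⟩
    (r C j) * ((λ u → c ^ j * monomial (map (j *_) t) u) ⊛ (B ^ˢ (r ∸ j))) m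
      ≡⟨ cong ((r C j) *_) (⊛-*ˡ (c ^ j) (monomial (map (j *_) t)) (B ^ˢ (r ∸ j)) m) ⟩
    (r C j) * (c ^ j * (monomial (map (j *_) t) ⊛ (B ^ˢ (r ∸ j))) m)
      ≡⟨ *-assoc (r C j) (c ^ j) _ ⟨
    (r C j) * c ^ j * (monomial (map (j *_) t) ⊛ (B ^ˢ (r ∸ j))) m ∎
    where open ≡-Reasoning

-- t₂· F  multiplies F by the first variable, and  ∑t· G  is  Σᵢ tᵢ₊₂ Gᵢ.
t₂· : Series → Series
t₂· F []          = 0
t₂· F (zero  ∷ v) = 0
t₂· F (suc a ∷ v) = F (a ∷ v)

∑t· : (ℕ → Series) → Series
∑t· G []      = 0
∑t· G (a ∷ v) = t₂· (G 0) (a ∷ v) + ∑t· (λ i w → G (suc i) (a ∷ w)) v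

t₂·-cong : ∀ {F F′} → F ≗ F′ → t₂· F ≗ t₂· F′
t₂·-cong eq []          = refl
t₂·-cong eq (zero  ∷ v) = refl
t₂·-cong eq (suc a ∷ v) = eq (a ∷ v)

∑t·-cong : ∀ {G G′ : ℕ → Series} → (∀ i → G i ≗ G′ i) → ∑t· G ≗ ∑t· G′
∑t·-cong eq []      = refl
∑t·-cong eq (a ∷ v) = cong₂ _+_ (t₂·-cong (eq 0) (a ∷ v)) (∑t·-cong (λ i w → eq (suc i) (a ∷ w)) v)

t₂·-∑< : ∀ n (K : ℕ → Series) → t₂· (λ w → ∑[ j < n ] K j w) ≗ (λ u → ∑[ j < n ] t₂· (K j) u)
t₂·-∑< n K []          = sym (∑<-zero n (λ _ → refl))
t₂·-∑< n K (zero  ∷ v) = sym (∑<-zero n (λ _ → refl))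
t₂·-∑< n K (suc a ∷ v) = refl

∑t·-∑< : ∀ n (K : ℕ → ℕ → Series) → ∑t· (λ i w → ∑[ j < n ] K j i w) ≗ (λ u → ∑[ j < n ] ∑t· (K j) u)
∑t·-∑< n K []      = sym (∑<-zero n (λ _ → refl))
∑t·-∑< n K (a ∷ v) = trans (cong₂ _+_ (t₂·-∑< n (λ j → K j 0) (a ∷ v)) (∑t·-∑< n (λ j i w → K j (suc i) (a ∷ w)) v))
                           (sym (∑<-+ n (λ j → t₂· (K j 0) (a ∷ v)) (λ j → ∑t· (λ i w → K j (suc i) (a ∷ w)) v)))

t₂·-⊛ : ∀ F H → t₂· F ⊛ H ≗ t₂· (F ⊛ H)
t₂·-⊛ F H []           = refl
t₂·-⊛ F H (zero  ∷ xs) = trans (⊛-∷ (t₂· F) H zero xs) (trans (+-identityʳ _) (sum-map-zero (λ _ → refl) (below xs)))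
t₂·-⊛ F H (suc x ∷ xs) = begin
  (t₂· F ⊛ H) (suc x ∷ xs)
    ≡⟨ ⊛-∷ (t₂· F) H (suc x) xs ⟩
  (∑[ v ≤ xs ] 0) + (∑[ a < suc x ] ((λ v → F (a ∷ v)) ⊛ (λ v → H (x ∸ a ∷ v))) xs)
    ≡⟨ cong (_+ (∑[ a < suc x ] ((λ v → F (a ∷ v)) ⊛ (λ v → H (x ∸ a ∷ v))) xs)) (sum-map-zero (λ _ → refl) (below xs)) ⟩
  (∑[ a < suc x ] ((λ v → F (a ∷ v)) ⊛ (λ v → H (x ∸ a ∷ v))) xs)
    ≡⟨ ⊛-∷ F H x xs ⟨
  (F ⊛ H) (x ∷ xs) ∎
  where open ≡-Reasoning

∑t·-⊛ : ∀ G H → ∑t· G ⊛ H ≗ ∑t· (λ i → G i ⊛ H)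
∑t·-⊛ G H []       = refl
∑t·-⊛ G H (x ∷ xs) = begin
  (∑t· G ⊛ H) (x ∷ xs)
    ≡⟨ ⊛-cong {G = H} ∑t·-∷ (λ _ → refl) (x ∷ xs) ⟩
  ((t₂· (G 0) +ˢ ∑t·-tail) ⊛ H) (x ∷ xs)
    ≡⟨ ⊛-distribʳ-+ H (t₂· (G 0)) ∑t·-tail (x ∷ xs) ⟩
  (t₂· (G 0) ⊛ H) (x ∷ xs) + (∑t·-tail ⊛ H) (x ∷ xs)
    ≡⟨ cong₂ _+_ (t₂·-⊛ (G 0) H (x ∷ xs)) (⊛-∷ ∑t·-tail H x xs) ⟩
  t₂· (G 0 ⊛ H) (x ∷ xs) + (∑[ a < suc x ] (∑t· (G′ a) ⊛ H′ a) xs)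
    ≡⟨ cong (t₂· (G 0 ⊛ H) (x ∷ xs) +_) (∑<-cong (suc x) (λ a → ∑t·-⊛ (G′ a) (H′ a) xs)) ⟩
  t₂· (G 0 ⊛ H) (x ∷ xs) + (∑[ a < suc x ] ∑t· (λ i → G′ a i ⊛ H′ a) xs)
    ≡⟨ cong (t₂· (G 0 ⊛ H) (x ∷ xs) +_) (∑t·-∑< (suc x) (λ a i → G′ a i ⊛ H′ a) xs) ⟨
  t₂· (G 0 ⊛ H) (x ∷ xs) + ∑t· (λ i w → ∑[ a < suc x ] (G′ a i ⊛ H′ a) w) xs
    ≡⟨ cong (t₂· (G 0 ⊛ H) (x ∷ xs) +_) (∑t·-cong (λ i w → ⊛-∷ (G (suc i)) H x w) xs) ⟨
  ∑t· (λ i → G i ⊛ H) (x ∷ xs) ∎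
  where
  open ≡-Reasoning
  G′ : ℕ → ℕ → Series
  G′ a i w = G (suc i) (a ∷ w)
  H′ : ℕ → Series
  H′ a w = H (x ∸ a ∷ w)
  ∑t·-tail : Series
  ∑t·-tail []      = 0
  ∑t·-tail (a ∷ v) = ∑t· (G′ a) v
  ∑t·-∷ : ∑t· G ≗ t₂· (G 0) +ˢ ∑t·-tail
  ∑t·-∷ []      = refl
  ∑t·-∷ (a ∷ v) = refl

wt-suc : ∀ k m → wt (suc k) m ≡ sum m + wt k m
wt-suc k []       = refl
wt-suc k (x ∷ xs) = trans (cong (suc k * x +_) (wt-suc (suc k) xs)) (lemma x k (sum xs) (wt (suc k) xs))
  where
  lemma : ∀ x k s w → suc k * x + (s + w) ≡ x + s + (k * x + w)
  lemma = solve-∀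

wt-+ : ∀ s k m → wt (s + k) m ≡ s * sum m + wt k m
wt-+ zero    k m = refl
wt-+ (suc s) k m = begin
  wt (suc s + k) m              ≡⟨ wt-suc (s + k) m ⟩
  sum m + wt (s + k) m          ≡⟨ cong (sum m +_) (wt-+ s k m) ⟩
  sum m + (s * sum m + wt k m)  ≡⟨ +-assoc (sum m) (s * sum m) (wt k m) ⟨
  suc s * sum m + wt k m        ∎
  where open ≡-Reasoning

wt-incr : ∀ k u a w → wt k (u ++ suc a ∷ w) ≡ k + length u + wt k (u ++ a ∷ w)
wt-incr k []      a w = lemma k a (wt (suc k) w)
  where
  lemma : ∀ k a r → k * suc a + r ≡ k + 0 + (k * a + r)
  lemma = solve-∀
wt-incr k (y ∷ u) a w = trans (cong (k * y +_) (wt-incr (suc k) u a w)) (lemma k y (length u) (wt (suc k) (u ++ a ∷ w)))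
  where
  lemma : ∀ k y l r → k * y + (suc k + l + r) ≡ k + suc l + (k * y + r)
  lemma = solve-∀

factProd-incr : ∀ u a w → factProd (u ++ suc a ∷ w) ≡ suc a * factProd (u ++ a ∷ w)
factProd-incr []      a w = *-assoc (suc a) (a !) (factProd w)
factProd-incr (y ∷ u) a w = trans (cong (y ! *_) (factProd-incr u a w)) (x∙yz≈y∙xz (y !) (suc a) _)

wt-zeroType : ∀ k m → isZeroType m ≡ true → wt k m ≡ 0
wt-zeroType k []           _  = refl
wt-zeroType k (zero  ∷ xs) eq = trans (cong (_+ wt (suc k) xs) (*-zeroʳ k)) (wt-zeroType (suc k) xs eq)

factProd-zeroType : ∀ m → isZeroType m ≡ true → factProd m ≡ 1
factProd-zeroType []           _  = refl
factProd-zeroType (zero  ∷ xs) eq = trans (+-identityʳ _) (factProd-zeroType xs eq)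

∑t·-zeroType : ∀ G m → isZeroType m ≡ true → ∑t· G m ≡ 0
∑t·-zeroType G []           _  = refl
∑t·-zeroType G (zero  ∷ xs) eq = ∑t·-zeroType _ xs eq

wt-nonzeroType : ∀ k m → isZeroType m ≡ false → k ≤ wt k m
wt-nonzeroType k (zero  ∷ xs) eq = begin
  k                    ≤⟨ n≤1+n k ⟩
  suc k                ≤⟨ wt-nonzeroType (suc k) xs eq ⟩
  wt (suc k) xs        ≡⟨ cong (_+ wt (suc k) xs) (*-zeroʳ k) ⟨
  k * 0 + wt (suc k) xs ∎
  where open ≤-Reasoning
wt-nonzeroType k (suc x ∷ xs) _  = ≤-trans (m≤m*n k (suc x)) (m≤m+n (k * suc x) _)

wt-mono : ∀ k {b m} → b ≤ᵀ m → wt k b ≤ wt k m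
wt-mono k []          = ≤-refl
wt-mono k (a≤x ∷ b≤m) = +-mono-≤ (*-monoʳ-≤ k a≤x) (wt-mono (suc k) b≤m)

-- wt c m = Σᵢ (c + i) mᵢ; the hypothesis is the i-th summand, for m = u ++ mᵢ ∷ w and i = length u.
∑t·-weighted : ∀ m (G : ℕ → Series) c Q K →
  (∀ u a w → m ≡ u ++ suc a ∷ w → G (length u) (u ++ a ∷ w) * Q ≡ suc a * (c + length u) * K) →
  ∑t· G m * Q ≡ wt c m * K
∑t·-weighted []      G c Q K hyp = refl
∑t·-weighted (x ∷ v) G c Q K hyp = begin
  (t₂· (G 0) (x ∷ v) + ∑t· G′ v) * Q        ≡⟨ *-distribʳ-+ Q (t₂· (G 0) (x ∷ v)) (∑t· G′ v) ⟩
  t₂· (G 0) (x ∷ v) * Q + ∑t· G′ v * Q      ≡⟨ cong₂ _+_ (head x refl) (∑t·-weighted v G′ (suc c) Q K hyp′) ⟩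
  c * x * K + wt (suc c) v * K              ≡⟨ *-distribʳ-+ K (c * x) _ ⟨
  (c * x + wt (suc c) v) * K                ∎
  where
  open ≡-Reasoning
  G′ : ℕ → Series
  G′ i w = G (suc i) (x ∷ w)
  head : ∀ y → x ≡ y → t₂· (G 0) (y ∷ v) * Q ≡ c * y * K
  head zero    _    = cong (_* K) (sym (*-zeroʳ c))
  head (suc a) x≡1+a = trans (hyp [] a v (cong (_∷ v) x≡1+a)) (lemma a c K)
    where
    lemma : ∀ a c K → suc a * (c + 0) * K ≡ c * suc a * K
    lemma = solve-∀
  hyp′ : ∀ u a w → v ≡ u ++ suc a ∷ w → G′ (length u) (u ++ a ∷ w) * Q ≡ suc a * (suc c + length u) * K
  hyp′ u a w v≡ = trans (hyp (x ∷ u) a w (cong (x ∷_) v≡)) (cong (λ l → suc a * l * K) (+-suc c (length u)))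

n*[n∸1]!≡n! : ∀ {n} → 1 ≤ n → n * (n ∸ 1) ! ≡ n !
n*[n∸1]!≡n! {suc n} _ = refl

divFact-exact : ∀ a c xs X → X * (c ! * factProd xs) ≡ a → divFact a c xs ≡ X
divFact-exact _ c xs X refl = m*n/n≡m X (c ! * factProd xs)
  where instance _ = m*n≢0 (c !) (factProd xs) {{c !≢0}} {{factProd≢0 xs}}

n*[n∸1+m]!≡n*[n+m∸1]! : ∀ n m → n * (n ∸ 1 + m) ! ≡ n * (n + m ∸ 1) !
n*[n∸1+m]!≡n*[n+m∸1]! zero    m = refl
n*[n∸1+m]!≡n*[n+m∸1]! (suc n) m = refl

wt-recurrence : ∀ s m → (suc s + wt 1 m) * s + wt (2 + s) m ≡ suc s * (s + wt 2 m)
wt-recurrence s m = begin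
  (suc s + wt 1 m) * s + wt (2 + s) m                ≡⟨ cong (λ k → (suc s + wt 1 m) * s + wt k m) (+-comm 2 s) ⟩
  (suc s + wt 1 m) * s + wt (s + 2) m                ≡⟨ cong ((suc s + wt 1 m) * s +_) (wt-+ s 2 m) ⟩
  (suc s + wt 1 m) * s + (s * sum m + wt 2 m)        ≡⟨ cong (λ e → (suc s + wt 1 m) * s + (s * sum m + e)) (wt-suc 1 m) ⟩
  (suc s + wt 1 m) * s + (s * sum m + (sum m + wt 1 m)) ≡⟨ lemma s (wt 1 m) (sum m) ⟩
  suc s * (s + (sum m + wt 1 m))                     ≡⟨ cong (λ e → suc s * (s + e)) (wt-suc 1 m) ⟨
  suc s * (s + wt 2 m)                               ∎
  where
  open ≡-Reasoning
  lemma : ∀ s e σ → (suc s + e) * s + (s * σ + (σ + e)) ≡ suc s * (s + (σ + e))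
  lemma = solve-∀

-- The closed formula

ClosedFormula : ℕ → Type → Set
ClosedFormula r m = (S ^ˢ r) m * ((r + wt 1 m) ! * factProd m) ≡ r * (r ∸ 1 + wt 2 m) !

ClosedFormulaBelow : Type → Set
ClosedFormulaBelow m = ∀ m′ → wt 2 m′ < wt 2 m → ∀ r → 1 ≤ r → ClosedFormula r m′

FunctionalEquation : Type → Set
FunctionalEquation b = S b ≡ one b + ∑t· (λ j → S ^ˢ (2 + j)) b

∑t·-S^ˢ : ∀ r m → ClosedFormulaBelow m →
  ∑t· (λ j → S ^ˢ (suc r + j)) m * ((r + wt 1 m) ! * factProd m) ≡ wt (suc r) m * (r + wt 2 m ∸ 2) !
∑t·-S^ˢ r m below = ∑t·-weighted m (λ j → S ^ˢ (suc r + j)) (suc r) _ _ term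
  where
  term : ∀ u a w → m ≡ u ++ suc a ∷ w →
    (S ^ˢ (suc r + length u)) (u ++ a ∷ w) * ((r + wt 1 m) ! * factProd m) ≡ suc a * (suc r + length u) * (r + wt 2 m ∸ 2) !
  term u a w refl = begin
    Sm′ * ((r + wt 1 (u ++ suc a ∷ w)) ! * factProd (u ++ suc a ∷ w))
      ≡⟨ cong₂ (λ e f → Sm′ * (e ! * f)) wt₁-incr (factProd-incr u a w) ⟩
    Sm′ * ((r′ + wt 1 m′) ! * (suc a * factProd m′))
      ≡⟨ rearrange Sm′ ((r′ + wt 1 m′) !) (suc a) (factProd m′) ⟩
    suc a * (Sm′ * ((r′ + wt 1 m′) ! * factProd m′))
      ≡⟨ cong (suc a *_) (below m′ lighter r′ (s≤s z≤n)) ⟩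
    suc a * (r′ * (r + length u + wt 2 m′) !)
      ≡⟨ *-assoc (suc a) r′ _ ⟨
    suc a * r′ * (r + length u + wt 2 m′) !
      ≡⟨ cong (λ e → suc a * r′ * e !) wt₂-incr ⟨
    suc a * r′ * (r + wt 2 (u ++ suc a ∷ w) ∸ 2) ! ∎
    where
    open ≡-Reasoning
    m′ = u ++ a ∷ w
    r′ = suc r + length u
    Sm′ = (S ^ˢ r′) m′
    wt₁-incr : r + wt 1 (u ++ suc a ∷ w) ≡ r′ + wt 1 m′
    wt₁-incr = trans (cong (r +_) (wt-incr 1 u a w)) (lemma r (length u) (wt 1 m′))
      where
      lemma : ∀ r l e → r + (1 + l + e) ≡ suc r + l + e
      lemma = solve-∀
    wt₂-incr : r + wt 2 (u ++ suc a ∷ w) ∸ 2 ≡ r + length u + wt 2 m′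
    wt₂-incr = cong (_∸ 2) (trans (cong (r +_) (wt-incr 2 u a w)) (lemma r (length u) (wt 2 m′)))
      where
      lemma : ∀ r l e → r + (2 + l + e) ≡ 2 + (r + l + e)
      lemma = solve-∀
    lighter : wt 2 m′ < wt 2 (u ++ suc a ∷ w)
    lighter = subst (wt 2 m′ <_) (sym (wt-incr 2 u a w)) (s≤s (m≤n+m (wt 2 m′) (suc (length u))))
    rearrange : ∀ s q a f → s * (q * (a * f)) ≡ a * (s * (q * f))
    rearrange = solve-∀

S-functionalEquation : ∀ b → ClosedFormulaBelow b → FunctionalEquation b
S-functionalEquation b below = divFact-exact ((wt 2 b) !) (1 + wt 1 b) b X (X-spec (isZeroType b) refl)
  where
  X = one b + ∑t· (λ j → S ^ˢ (2 + j)) b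
  Q = (1 + wt 1 b) ! * factProd b
  X-spec : ∀ z → isZeroType b ≡ z → X * Q ≡ (wt 2 b) !
  X-spec true  b≡0 = begin
    X * Q                                      ≡⟨ cong₂ (λ o p → (o + p) * Q) (cong (if_then 1 else 0) b≡0) (∑t·-zeroType _ b b≡0) ⟩
    (1 + 0) * ((1 + wt 1 b) ! * factProd b)    ≡⟨ cong₂ (λ e f → (1 + 0) * ((1 + e) ! * f)) (wt-zeroType 1 b b≡0) (factProd-zeroType b b≡0) ⟩
    1                                          ≡⟨ cong _! (wt-zeroType 2 b b≡0) ⟨
    (wt 2 b) !                                 ∎
    where open ≡-Reasoning
  X-spec false b≢0 = begin
    X * Q                                          ≡⟨ *-distribʳ-+ Q (one b) _ ⟩
    one b * Q + ∑t· (λ j → S ^ˢ (2 + j)) b * Q     ≡⟨ cong₂ _+_ (cong (λ o → (if o then 1 else 0) * Q) b≢0) (∑t·-S^ˢ 1 b below) ⟩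
    wt 2 b * (wt 2 b ∸ 1) !                        ≡⟨ n*[n∸1]!≡n! (≤-trans (s≤s z≤n) (wt-nonzeroType 2 b b≢0)) ⟩
    (wt 2 b) !                                     ∎
    where open ≡-Reasoning

S^ˢ-suc : ∀ s m → (∀ b → b ≤ᵀ m → FunctionalEquation b) →
  (S ^ˢ suc s) m ≡ (S ^ˢ s) m + ∑t· (λ j → S ^ˢ (2 + s + j)) m
S^ˢ-suc s m fe = begin
  (S ⊛ (S ^ˢ s)) m                                 ≡⟨ ⊛-cong-≤ᵀ {G = S ^ˢ s} m fe (λ _ _ → refl) ⟩
  ((one +ˢ ∑t· G) ⊛ (S ^ˢ s)) m                    ≡⟨ ⊛-distribʳ-+ (S ^ˢ s) one (∑t· G) m ⟩
  (one ⊛ (S ^ˢ s)) m + (∑t· G ⊛ (S ^ˢ s)) m        ≡⟨ cong₂ _+_ (⊛-identityˡ (S ^ˢ s) m) (∑t·-⊛ G (S ^ˢ s) m) ⟩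
  (S ^ˢ s) m + ∑t· (λ j → G j ⊛ (S ^ˢ s)) m        ≡⟨ cong ((S ^ˢ s) m +_) (∑t·-cong G⊛S^ˢ m) ⟩
  (S ^ˢ s) m + ∑t· (λ j → S ^ˢ (2 + s + j)) m      ∎
  where
  open ≡-Reasoning
  G : ℕ → Series
  G j = S ^ˢ (2 + j)
  G⊛S^ˢ : ∀ j → G j ⊛ (S ^ˢ s) ≗ S ^ˢ (2 + s + j)
  G⊛S^ˢ j w = trans (sym (^ˢ-+ S (2 + j) s w)) (cong (λ k → (S ^ˢ (2 + k)) w) (+-comm j s))

closedFormula-zeroType : ∀ m → isZeroType m ≡ true → (∀ b → b ≤ᵀ m → FunctionalEquation b) →
  ∀ r → ClosedFormula (suc r) m
closedFormula-zeroType m m≡0 fe r = begin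
  (S ^ˢ suc r) m * ((suc r + wt 1 m) ! * factProd m) ≡⟨ cong₂ (λ c e → c * ((suc r + e) ! * factProd m)) (S^ˢ≡1 (suc r)) (wt-zeroType 1 m m≡0) ⟩
  1 * ((suc r + 0) ! * factProd m)                   ≡⟨ cong₂ (λ e f → 1 * ((suc e) ! * f)) (+-identityʳ r) (factProd-zeroType m m≡0) ⟩
  1 * ((suc r) ! * 1)                                ≡⟨ trans (*-identityˡ _) (*-identityʳ _) ⟩
  suc r * r !                                        ≡⟨ cong (λ e → suc r * e !) (trans (cong (r +_) (wt-zeroType 2 m m≡0)) (+-identityʳ r)) ⟨
  suc r * (r + wt 2 m) !                             ∎
  where
  open ≡-Reasoning
  S^ˢ≡1 : ∀ s → (S ^ˢ s) m ≡ 1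
  S^ˢ≡1 zero    = cong (if_then 1 else 0) m≡0
  S^ˢ≡1 (suc s) = trans (S^ˢ-suc s m fe) (cong₂ _+_ (S^ˢ≡1 s) (∑t·-zeroType _ m m≡0))

closedFormula-nonzeroType : ∀ m → isZeroType m ≡ false → ClosedFormulaBelow m →
  (∀ b → b ≤ᵀ m → FunctionalEquation b) → ∀ s → ClosedFormula s m
-- For m ≠ 0 the case s = 0 holds too, as both sides vanish; it starts the induction on s.
closedFormula-nonzeroType m m≢0 below fe zero    = cong (λ o → (if o then 1 else 0) * ((0 + wt 1 m) ! * factProd m)) m≢0
closedFormula-nonzeroType m m≢0 below fe (suc s) = begin
  (S ^ˢ suc s) m * Q                                        ≡⟨ cong (_* Q) (S^ˢ-suc s m fe) ⟩
  ((S ^ˢ s) m + ∑t· (λ j → S ^ˢ (2 + s + j)) m) * Q         ≡⟨ *-distribʳ-+ Q ((S ^ˢ s) m) _ ⟩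
  (S ^ˢ s) m * Q + ∑t· (λ j → S ^ˢ (2 + s + j)) m * Q       ≡⟨ cong₂ _+_ first-term (∑t·-S^ˢ (suc s) m below) ⟩
  (suc s + E) * (s * (s + W ∸ 1) !) + wt (2 + s) m * K      ≡⟨ factor-out (suc s + E) s K (wt (2 + s) m) ⟩
  ((suc s + E) * s + wt (2 + s) m) * K                      ≡⟨ cong (_* K) (wt-recurrence s m) ⟩
  suc s * (s + W) * K                                       ≡⟨ *-assoc (suc s) (s + W) K ⟩
  suc s * ((s + W) * (s + W ∸ 1) !)                         ≡⟨ cong (suc s *_) (n*[n∸1]!≡n! 1≤s+W) ⟩
  suc s * (s + W) !                                         ∎
  where
  open ≡-Reasoning
  E = wt 1 m
  W = wt 2 m
  Q = (suc s + E) ! * factProd m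
  K = (s + W ∸ 1) !
  1≤s+W : 1 ≤ s + W
  1≤s+W = ≤-trans (s≤s z≤n) (≤-trans (wt-nonzeroType 2 m m≢0) (m≤n+m W s))
  rearrange : ∀ c q p f → c * (q * p * f) ≡ q * (c * (p * f))
  rearrange = solve-∀
  first-term : (S ^ˢ s) m * Q ≡ (suc s + E) * (s * (s + W ∸ 1) !)
  first-term = begin
    (S ^ˢ s) m * ((suc s + E) * (s + E) ! * factProd m)   ≡⟨ rearrange ((S ^ˢ s) m) (suc s + E) ((s + E) !) (factProd m) ⟩
    (suc s + E) * ((S ^ˢ s) m * ((s + E) ! * factProd m)) ≡⟨ cong ((suc s + E) *_) (closedFormula-nonzeroType m m≢0 below fe s) ⟩
    (suc s + E) * (s * (s ∸ 1 + W) !)                     ≡⟨ cong ((suc s + E) *_) (n*[n∸1+m]!≡n*[n+m∸1]! s W) ⟩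
    (suc s + E) * (s * (s + W ∸ 1) !)                     ∎
  factor-out : ∀ c s k w → c * (s * k) + w * k ≡ (c * s + w) * k
  factor-out = solve-∀

functionalEquation-below : ∀ m → ClosedFormulaBelow m → ∀ b → b ≤ᵀ m → FunctionalEquation b
functionalEquation-below m below b b≤m = S-functionalEquation b (λ m′ lighter → below m′ (<-≤-trans lighter (wt-mono 2 b≤m)))

closedFormula : ∀ m r → 1 ≤ r → ClosedFormula r m
closedFormula = WellFounded.All.wfRec (On.wellFounded (wt 2) <-wellFounded) _ (λ m → ∀ r → 1 ≤ r → ClosedFormula r m) step
  where
  step : ∀ m → (∀ {m′} → wt 2 m′ < wt 2 m → ∀ r → 1 ≤ r → ClosedFormula r m′) → ∀ r → 1 ≤ r → ClosedFormula r m
  step m rec (suc r) _ with isZeroType m in m≟0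
  ... | true  = closedFormula-zeroType m m≟0 (functionalEquation-below m (λ _ → rec)) r
  ... | false = closedFormula-nonzeroType m m≟0 (λ _ → rec) (functionalEquation-below m (λ _ → rec)) (suc r)

[k+s]Ck*[k!*s!]≡[k+s]! : ∀ k s → ((k + s) C k) * (k ! * s !) ≡ (k + s) !
[k+s]Ck*[k!*s!]≡[k+s]! k s = begin
  ((k + s) C k) * (k ! * s !)                                  ≡⟨ cong (λ d → ((k + s) C k) * (k ! * d !)) (m+n∸m≡n k s) ⟨
  ((k + s) C k) * (k ! * (k + s ∸ k) !)                        ≡⟨ cong (_* (k ! * (k + s ∸ k) !)) (nCk≡n!/k![n-k]! k≤k+s) ⟩
  (k + s) ! / (k ! * (k + s ∸ k) !) * (k ! * (k + s ∸ k) !) ≡⟨ m/n*n≡m (k![n∸k]!∣n! k≤k+s) ⟩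
  (k + s) !                                                  ∎
  where
  open ≡-Reasoning
  k≤k+s = m≤m+n k s
  instance _ = k !* (k + s ∸ k) !≢0

binomialProduct : List ℕ → ℕ
binomialProduct []       = 1
binomialProduct (k ∷ ks) = ((k + sum ks) C k) * binomialProduct ks

binomialProduct*factProd : ∀ ks → binomialProduct ks * factProd ks ≡ (sum ks) !
binomialProduct*factProd []       = refl
binomialProduct*factProd (k ∷ ks) = begin
  ((k + sum ks) C k) * binomialProduct ks * (k ! * factProd ks)   ≡⟨ rearrange ((k + sum ks) C k) (binomialProduct ks) (k !) (factProd ks) ⟩
  ((k + sum ks) C k) * (k ! * (binomialProduct ks * factProd ks)) ≡⟨ cong (λ f → ((k + sum ks) C k) * (k ! * f)) (binomialProduct*factProd ks) ⟩
  ((k + sum ks) C k) * (k ! * (sum ks) !)                          ≡⟨ [k+s]Ck*[k!*s!]≡[k+s]! k (sum ks) ⟩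
  (k + sum ks) !                                                 ∎
  where
  open ≡-Reasoning
  rearrange : ∀ c b p f → c * b * (p * f) ≡ c * (p * (b * f))
  rearrange = solve-∀

multinomial≡binomialProduct : ∀ r ks → sum ks ≡ r → multinomial r ks ≡ binomialProduct ks
multinomial≡binomialProduct _ ks refl =
  divFact-exact ((sum ks) !) 0 ks (binomialProduct ks)
    (trans (cong (binomialProduct ks *_) (+-identityʳ (factProd ks))) (binomialProduct*factProd ks))

multinomial-∷ : ∀ r j ks → j ≤ r → sum ks ≡ r ∸ j → multinomial r (j ∷ ks) ≡ (r C j) * multinomial (r ∸ j) ks
multinomial-∷ r j ks j≤r Σks≡r∸j = begin
  multinomial r (j ∷ ks)                  ≡⟨ multinomial≡binomialProduct r (j ∷ ks) j+Σks≡r ⟩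
  ((j + sum ks) C j) * binomialProduct ks ≡⟨ cong₂ (λ n b → (n C j) * b) j+Σks≡r (sym (multinomial≡binomialProduct (r ∸ j) ks Σks≡r∸j)) ⟩
  (r C j) * multinomial (r ∸ j) ks        ∎
  where
  open ≡-Reasoning
  j+Σks≡r : j + sum ks ≡ r
  j+Σks≡r = trans (cong (j +_) Σks≡r∸j) (m+[n∸m]≡n j≤r)

-- The multinomial expansion

comps-suc : ∀ r L → comps r (suc L) ≡ concatMap (λ j → map (j ∷_) (comps (r ∸ j) L)) (upTo (suc r))
comps-suc zero    L = refl
comps-suc (suc r) L = refl

sum-map-comps-suc : ∀ r L (f : List ℕ → ℕ) →
  sum (map f (comps r (suc L))) ≡ (∑[ j < suc r ] sum (map (f ∘ (j ∷_)) (comps (r ∸ j) L)))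
sum-map-comps-suc r L f = trans (cong (sum ∘ map f) (comps-suc r L)) (sum-map-concatMap-∷ r (λ j → comps (r ∸ j) L) f)

comps-sum : ∀ r L → All (λ ks → sum ks ≡ r) (comps r L)
comps-sum zero    zero    = refl ∷ []
comps-sum (suc r) zero    = []
comps-sum r       (suc L) = subst (All (λ ks → sum ks ≡ r)) (sym (comps-suc r L))
  (concat⁺ (map⁺ (applyUpTo⁺₁ (λ j → j) (suc r) (λ {j} j<1+r →
    map⁺ (All.map (λ Σks≡r∸j → trans (cong (j +_) Σks≡r∸j) (m+[n∸m]≡n (s≤s⁻¹ j<1+r))) (comps-sum (r ∸ j) L))))))

if-then-else-0 : ∀ b X → (if b then X else 0) ≡ (if b then 1 else 0) * X
if-then-else-0 true  X = sym (+-identityʳ X)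
if-then-else-0 false X = refl

polynomial : Series → List Type → Series
polynomial F ts b = sum (map (λ t → monomial t b * F t) ts)

module _ (F : Series) (len : ℕ) where

  expansionTerm : ℕ → List Type → Type → List ℕ → ℕ
  expansionTerm r ts m ks = if ⌊ ≡-dec _≟_ (linComb len ks ts) m ⌋
                            then multinomial r ks * product (zipWith (λ k n → F n ^ k) ks ts) else 0

  -- multSum r m unfolds to  multinomialExpansion S (length m) r (below m) m.
  multinomialExpansion : ℕ → List Type → Type → ℕ
  multinomialExpansion r ts m = sum (map (expansionTerm r ts m) (comps r (length ts)))

  linComb-length : ∀ ks ts → All (λ t → length t ≡ len) ts → length (linComb len ks ts) ≡ len
  linComb-length []       ts       _             = length-replicate len
  linComb-length (k ∷ ks) []       _             = length-replicate len
  linComb-length (k ∷ ks) (t ∷ ts) (|t| ∷ |ts|) = begin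
    length (zipWith _+_ (map (k *_) t) (linComb len ks ts)) ≡⟨ length-zipWith _+_ (map (k *_) t) _ ⟩
    length (map (k *_) t) ⊓ length (linComb len ks ts)     ≡⟨ cong₂ _⊓_ (trans (length-map (k *_) t) |t|) (linComb-length ks ts |ts|) ⟩
    len ⊓ len                                               ≡⟨ ⊓-idem len ⟩
    len                                                     ∎
    where open ≡-Reasoning

  -- In the (t ∷ ts)-expansion, the terms with k_t = j are those of the ts-expansion shifted by j t.
  expansionTerm-∷ : ∀ r j t ts m ks → j ≤ r → sum ks ≡ r ∸ j →
    length t ≡ len → All (λ t → length t ≡ len) ts → length m ≡ len →
    expansionTerm r (t ∷ ts) m (j ∷ ks) ≡ (r C j) * F t ^ j * (∑[ b ≤ m ] monomial (map (j *_) t) b * expansionTerm (r ∸ j) ts (m ∸ᵀ b) ks)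
  expansionTerm-∷ r j t ts m ks j≤r Σks |t| |ts| |m| = begin
    expansionTerm r (t ∷ ts) m (j ∷ ks)
      ≡⟨ if-then-else-0 ⌊ ≡-dec _≟_ (zipWith _+_ jt lc) m ⌋ _ ⟩
    monomial (zipWith _+_ jt lc) m * (multinomial r (j ∷ ks) * (F t ^ j * Π))
      ≡⟨ cong₂ (λ x y → x * (y * (F t ^ j * Π))) (sym (monomial-⊛ m jt lc |jt| |lc|)) (multinomial-∷ r j ks j≤r Σks) ⟩
    (monomial jt ⊛ monomial lc) m * ((r C j) * X * (F t ^ j * Π))
      ≡⟨ sum-map-*ʳ ((r C j) * X * (F t ^ j * Π)) (λ b → monomial jt b * monomial lc (m ∸ᵀ b)) (below m) ⟨
    (∑[ b ≤ m ] monomial jt b * monomial lc (m ∸ᵀ b) * ((r C j) * X * (F t ^ j * Π)))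
      ≡⟨ ∑≤-cong m (λ b _ → rearrange (monomial jt b) (monomial lc (m ∸ᵀ b)) (r C j) X (F t ^ j) Π) ⟩
    (∑[ b ≤ m ] (r C j) * F t ^ j * (monomial jt b * (monomial lc (m ∸ᵀ b) * (X * Π))))
      ≡⟨ sum-map-*ˡ ((r C j) * F t ^ j) (λ b → monomial jt b * (monomial lc (m ∸ᵀ b) * (X * Π))) (below m) ⟩
    (r C j) * F t ^ j * (∑[ b ≤ m ] monomial jt b * (monomial lc (m ∸ᵀ b) * (X * Π)))
      ≡⟨ cong ((r C j) * F t ^ j *_) (∑≤-cong m (λ b _ → cong (monomial jt b *_) (sym (if-then-else-0 ⌊ ≡-dec _≟_ lc (m ∸ᵀ b) ⌋ (X * Π))))) ⟩
    (r C j) * F t ^ j * (∑[ b ≤ m ] monomial jt b * expansionTerm (r ∸ j) ts (m ∸ᵀ b) ks) ∎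
    where
    open ≡-Reasoning
    jt = map (j *_) t
    lc = linComb len ks ts
    Π = product (zipWith (λ k n → F n ^ k) ks ts)
    X = multinomial (r ∸ j) ks
    |jt| : length jt ≡ length m
    |jt| = trans (length-map (j *_) t) (trans |t| (sym |m|))
    |lc| : length lc ≡ length m
    |lc| = trans (linComb-length ks ts |ts|) (sym |m|)
    rearrange : ∀ d e b x p q → d * e * (b * x * (p * q)) ≡ b * p * (d * (e * (x * q)))
    rearrange = solve-∀

  polynomial-^ˢ : ∀ ts → All (λ t → length t ≡ len) ts → ∀ r m → length m ≡ len →
    (polynomial F ts ^ˢ r) m ≡ multinomialExpansion r ts m
  polynomial-^ˢ []       _            zero    m |m| = begin
    one m                                                  ≡⟨ one≗monomial-0 m ⟩
    monomial (replicate (length m) 0) m                    ≡⟨ cong (λ l → monomial (replicate l 0) m) |m| ⟩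
    monomial (replicate len 0) m                           ≡⟨ *-identityʳ _ ⟨
    monomial (replicate len 0) m * 1                       ≡⟨ cong (monomial (replicate len 0) m *_) multinomial-0-[] ⟨
    monomial (replicate len 0) m * (multinomial 0 [] * 1)  ≡⟨ if-then-else-0 ⌊ ≡-dec _≟_ (replicate len 0) m ⌋ _ ⟨
    expansionTerm 0 [] m []                                ≡⟨ +-identityʳ _ ⟨
    multinomialExpansion zero [] m                         ∎
    where
    open ≡-Reasoning
    multinomial-0-[] : multinomial 0 [] * 1 ≡ 1
    multinomial-0-[] = trans (*-identityʳ _) (multinomial≡binomialProduct 0 [] refl)
  polynomial-^ˢ []       _            (suc r) m |m| = ⊛-zeroˡ (polynomial F [] ^ˢ r) m
  polynomial-^ˢ (t ∷ ts) (|t| ∷ |ts|) r       m |m| = begin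
    (polynomial F (t ∷ ts) ^ˢ r) m
      ≡⟨ ⊛-binomial-monomial (F t) t (polynomial F ts) r m (trans |m| (sym |t|)) ⟩
    (∑[ j < suc r ] (r C j) * F t ^ j * (monomial (map (j *_) t) ⊛ (polynomial F ts ^ˢ (r ∸ j))) m)
      ≡⟨ ∑<-cong-< (suc r) (λ j j<1+r → sym (terms-with-head j (s≤s⁻¹ j<1+r))) ⟩
    (∑[ j < suc r ] sum (map (expansionTerm r (t ∷ ts) m ∘ (j ∷_)) (comps (r ∸ j) (length ts))))
      ≡⟨ sum-map-comps-suc r (length ts) (expansionTerm r (t ∷ ts) m) ⟨
    multinomialExpansion r (t ∷ ts) m ∎
    where
    open ≡-Reasoning
    terms-with-head : ∀ j → j ≤ r →
      sum (map (expansionTerm r (t ∷ ts) m ∘ (j ∷_)) (comps (r ∸ j) (length ts)))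
        ≡ (r C j) * F t ^ j * (monomial (map (j *_) t) ⊛ (polynomial F ts ^ˢ (r ∸ j))) m
    terms-with-head j j≤r = begin
      sum (map (expansionTerm r (t ∷ ts) m ∘ (j ∷_)) Ks)
        ≡⟨ cong sum (map-cong-local (All.map (λ {ks} Σks → expansionTerm-∷ r j t ts m ks j≤r Σks |t| |ts| |m|) (comps-sum (r ∸ j) (length ts)))) ⟩
      sum (map (λ ks → c * (∑[ b ≤ m ] δjt b * term ks b)) Ks)
        ≡⟨ sum-map-*ˡ c (λ ks → ∑[ b ≤ m ] δjt b * term ks b) Ks ⟩
      c * sum (map (λ ks → ∑[ b ≤ m ] δjt b * term ks b) Ks)
        ≡⟨ cong (c *_) (sum-map-swap (λ ks b → δjt b * term ks b) Ks (below m)) ⟩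
      c * (∑[ b ≤ m ] sum (map (λ ks → δjt b * term ks b) Ks))
        ≡⟨ cong (c *_) (∑≤-cong m (λ b b≤m → trans (sum-map-*ˡ (δjt b) (λ ks → term ks b) Ks)
             (cong (δjt b *_) (sym (polynomial-^ˢ ts |ts| (r ∸ j) (m ∸ᵀ b) (trans (Pointwise-length (∸ᵀ-≤ᵀ b≤m)) |m|)))))) ⟩
      c * (monomial (map (j *_) t) ⊛ (polynomial F ts ^ˢ (r ∸ j))) m ∎
      where
      Ks = comps (r ∸ j) (length ts)
      c = (r C j) * F t ^ j
      δjt = monomial (map (j *_) t)
      term : List ℕ → Type → ℕ
      term ks b = expansionTerm (r ∸ j) ts (m ∸ᵀ b) ks

theorem4 : (r : ℕ) → 1 ≤ r → (m : Type) →
    ((S ^ˢ r) m * ((r + wt 1 m) ! * factProd m) ≡ r * (r ∸ 1 + wt 2 m) !)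
    × ((S ^ˢ r) m ≡ multSum r m)
theorem4 r 1≤r m = closedFormula m r 1≤r , expansion
  where
  open ≡-Reasoning
  |m| = length m
  expansion : (S ^ˢ r) m ≡ multSum r m
  expansion = begin
    (S ^ˢ r) m                            ≡⟨ ^ˢ-cong-≤ᵀ m (λ b b≤m → sym (∑≤-monomial m b b≤m S)) r ⟩
    (polynomial S (below m) ^ˢ r) m   ≡⟨ polynomial-^ˢ S |m| (below m) (All.map Pointwise-length (below-≤ᵀ m)) r m refl ⟩
    multSum r m                           ∎
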